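{- Let $F$ be a CNF formula, let $\alpha$ be an assignment satisfying $F$, and let $\alpha_1,\dots,\alpha_t$ be assignments each falsifying $F$. Then one can choose, for each $i\in[t]$, a clause $C_i\in F$ and a literal $m_i$ such that $\alpha_i\models m_i$, $\alpha\models\overline{m_i}$, and $\overline{m_i}\in C_i$, and such that moreover, for all $i,j\in[t]$, if $C_i=C_j$ and $m_i\ne m_j$ then $\alpha_i\models m_j$ and $\alpha_j\models m_i$.
   Context: A CNF formula is a set of clauses, each a set of literals; assignments are total on the variables of $F$. -}

module Defs where

open import Data.Nat using (ℕ)
open import Data.Fin using (Fin)
open import Data.Bool using (Bool; not)
open import Data.Product using (_×_; _,_)
open import Data.List using (List)
open import Data.List.Relation.Unary.Any using (Any)
open import Data.List.Relation.Unary.All using (All)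
open import Relation.Binary.PropositionalEquality using (_≡_)
open import Relation.Nullary using (¬_)

-- Variables are Fin n.  A literal is a variable with a polarity:
-- (x , true) is the positive literal x, (x , false) is ¬x.
Literal : ℕ → Set
Literal n = Fin n × Bool

‾_ : ∀ {n} → Literal n → Literal n
‾ (x , b) = (x , not b)

Clause : ℕ → Set
Clause n = List (Literal n)

CNF : ℕ → Set
CNF n = List (Clause n)

Assignment : ℕ → Set
Assignment n = Fin n → Bool

_⊨ₗ_ : ∀ {n} → Assignment n → Literal n → Set
α ⊨ₗ (x , b) = α x ≡ b

_⊨ᶜ_ : ∀ {n} → Assignment n → Clause n → Set
α ⊨ᶜ C = Any (α ⊨ₗ_) C

_⊨_ : ∀ {n} → Assignment n → CNF n → Set
α ⊨ F = All (α ⊨ᶜ_) F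

_⊭_ : ∀ {n} → Assignment n → CNF n → Set
α ⊭ F = ¬ (α ⊨ F)

{-# OPTIONS --safe #-}

-- Each αᵢ falsifies some clause Cᵢ ∈ F, which α satisfies through some literal; mᵢ is the
-- complement of that literal. As αᵢ falsifies every literal of Cᵢ, whenever Cᵢ = Cⱼ it
-- satisfies mⱼ, whose complement lies in Cⱼ.
module Submission where

open import Defs
open import Data.Nat using (ℕ)
open import Data.Fin using (Fin)
open import Data.Bool using (true; false; _≟_)
open import Data.Bool.Properties using (¬-not)
open import Data.Product using (Σ; ∃; _×_; _,_)
open import Data.List.Relation.Unary.Any using (any?)
open import Data.List.Relation.Unary.All using (lookup)
open import Data.List.Relation.Unary.All.Properties using (¬All⇒Any¬)
open import Data.List.Membership.Propositional using (_∈_; find; lose)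
open import Function using (_∘_)
open import Relation.Binary.PropositionalEquality using (_≡_; refl; sym; subst)
open import Relation.Nullary using (¬_; Dec)

private
  variable
    n : ℕ

‾-involutive : (l : Literal n) → ‾ (‾ l) ≡ l
‾-involutive (_ , true)  = refl
‾-involutive (_ , false) = refl

_⊨ᶜ?_ : (β : Assignment n) (C : Clause n) → Dec (β ⊨ᶜ C)
β ⊨ᶜ? C = any? (λ (x , b) → β x ≟ b) C

¬⊨ₗ‾⇒⊨ₗ : ∀ {β : Assignment n} l → ¬ β ⊨ₗ (‾ l) → β ⊨ₗ l
¬⊨ₗ‾⇒⊨ₗ (_ , true)  = ¬-not
¬⊨ₗ‾⇒⊨ₗ (_ , false) = ¬-not

¬⊨ᶜ∧‾∈⇒⊨ₗ : ∀ {β : Assignment n} {C l} → ¬ β ⊨ᶜ C → ‾ l ∈ C → β ⊨ₗ l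
¬⊨ᶜ∧‾∈⇒⊨ₗ {β = β} {l = l} β⊭C ‾l∈C = ¬⊨ₗ‾⇒⊨ₗ {β = β} l (β⊭C ∘ lose ‾l∈C)

⊭⇒∃¬⊨ᶜ : ∀ {β : Assignment n} {F} → β ⊭ F → ∃ λ C → C ∈ F × ¬ β ⊨ᶜ C
⊭⇒∃¬⊨ᶜ {β = β} {F} β⊭F = find (¬All⇒Any¬ (β ⊨ᶜ?_) F β⊭F)

record Separation (α β : Assignment n) (F : CNF n) : Set where
  field
    clause          : Clause n
    clause∈F        : clause ∈ F
    β⊭clause        : ¬ β ⊨ᶜ clause
    literal         : Literal n
    ‾literal∈clause : ‾ literal ∈ clause
    α⊨‾literal      : α ⊨ₗ (‾ literal)

  β⊨literal : β ⊨ₗ literal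
  β⊨literal = ¬⊨ᶜ∧‾∈⇒⊨ₗ β⊭clause ‾literal∈clause

separation : ∀ {α β : Assignment n} {F} → α ⊨ F → β ⊭ F → Separation α β F
separation {α = α} α⊨F β⊭F =
  let C , C∈F , β⊭C = ⊭⇒∃¬⊨ᶜ β⊭F
      l , l∈C , α⊨l = find (lookup α⊨F C∈F)
      ‾‾l≡l         = sym (‾-involutive l)
  in record
    { clause          = C
    ; clause∈F        = C∈F
    ; β⊭clause        = β⊭C
    ; literal         = ‾ l
    ; ‾literal∈clause = subst (_∈ C) ‾‾l≡l l∈C
    ; α⊨‾literal      = subst (α ⊨ₗ_) ‾‾l≡l α⊨l
    }

lemma24 : ∀ {n : ℕ} (F : CNF n) (α : Assignment n) → α ⊨ F →
    (t : ℕ) (αs : Fin t → Assignment n) → (∀ i → αs i ⊭ F) →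
    Σ (Fin t → Clause n) λ C → Σ (Fin t → Literal n) λ m →
    (∀ i → (C i ∈ F) × (αs i ⊨ₗ m i) × (α ⊨ₗ (‾ m i)) × ((‾ m i) ∈ C i))
    × (∀ i j → C i ≡ C j → ¬ (m i ≡ m j) → (αs i ⊨ₗ m j) × (αs j ⊨ₗ m i))
lemma24 F α α⊨F t αs αs⊭F = clause ∘ s , literal ∘ s , separates , agree
  where
  open Separation

  s : ∀ i → Separation α (αs i) F
  s i = separation α⊨F (αs⊭F i)

  separates : ∀ i → (clause (s i) ∈ F) × (αs i ⊨ₗ literal (s i))
                    × (α ⊨ₗ (‾ literal (s i))) × (‾ literal (s i) ∈ clause (s i))
  separates i = clause∈F (s i) , β⊨literal (s i) , α⊨‾literal (s i) , ‾literal∈clause (s i)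

  agree : ∀ i j → clause (s i) ≡ clause (s j) → ¬ (literal (s i) ≡ literal (s j))
        → (αs i ⊨ₗ literal (s j)) × (αs j ⊨ₗ literal (s i))
  agree i j Ci≡Cj _ =
      ¬⊨ᶜ∧‾∈⇒⊨ₗ (β⊭clause (s i)) (subst (‾ literal (s j) ∈_) (sym Ci≡Cj) (‾literal∈clause (s j)))
    , ¬⊨ᶜ∧‾∈⇒⊨ₗ (β⊭clause (s j)) (subst (‾ literal (s i) ∈_) Ci≡Cj (‾literal∈clause (s i)))
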